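{- For every integer $n\ge 1$, the square $P_n^2$ of the path $P_n$ is odd prime.
   Context: All graphs are finite and simple. An odd prime labeling of a graph $G$ with $N$ vertices is a bijection $\ell:V(G)\to\{1,3,\dots,2N-1\}$ such that $\gcd(\ell(u),\ell(v))=1$ for every edge $uv$; $G$ is odd prime if it has one. $P_n$ is the path on $n$ vertices. For a graph $G$ and $k\ge 1$, the $k$th power $G^k$ has the same vertex set as $G$, with distinct vertices $u,v$ adjacent iff their distance in $G$ is at most $k$. -}

module Defs where

open import Data.Nat using (ℕ; zero; suc; _+_; _*_; _≤_)
open import Data.Fin using (Fin; toℕ)
open import Data.Nat.Coprimality using (Coprime)
open import Data.Product using (Σ; _×_; ∃; ∃-syntax; _,_)
open import Relation.Binary.PropositionalEquality using (_≡_; refl; sym; subst)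
open import Relation.Nullary using (¬_)
open import Function.Bundles using (_⤖_; Bijection)
open import Level using (0ℓ)

record Graph (N : ℕ) : Set₁ where
  field
    Adj   : Fin N → Fin N → Set
    adj-sym : ∀ {u v} → Adj u v → Adj v u
    irrefl : ∀ {u} → ¬ Adj u u
open Graph public

PathAdj : ∀ {n} → Fin n → Fin n → Set
PathAdj i j = (suc (toℕ i) ≡ toℕ j) Data.Sum.⊎ (suc (toℕ j) ≡ toℕ i)
  where import Data.Sum

open import Data.Sum using (_⊎_; inj₁; inj₂)

pathSym : ∀ {n} {i j : Fin n} → PathAdj i j → PathAdj j i
pathSym (inj₁ p) = inj₂ p
pathSym (inj₂ p) = inj₁ p

open import Data.Nat.Properties using (1+n≢n)


pathIrrefl : ∀ {n} {i : Fin n} → ¬ PathAdj i i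
pathIrrefl {i = i} (inj₁ p) = 1+n≢n p
pathIrrefl {i = i} (inj₂ p) = 1+n≢n p

P : (n : ℕ) → Graph n
P n = record { Adj = PathAdj ; adj-sym = pathSym ; irrefl = pathIrrefl }

data Walk {N : ℕ} (G : Graph N) : ℕ → Fin N → Fin N → Set where
  here : ∀ {u} → Walk G zero u u
  step : ∀ {m u w v} → Adj G u w → Walk G m w v → Walk G (suc m) u v

DistLe : ∀ {N} → Graph N → ℕ → Fin N → Fin N → Set
DistLe G k u v = ∃[ m ] (m ≤ k × Walk G m u v)

PowAdj : ∀ {N} → Graph N → ℕ → Fin N → Fin N → Set
PowAdj G k u v = (¬ u ≡ v) × DistLe G k u v

revWalk : ∀ {N} {G : Graph N} {m u v} → Walk G m u v → Walk G m v u
revWalk {G = G} {m} {u} {v} w = subst (λ t → Walk G t v u) (+-identityʳ m) (go w here)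
  where
  open import Data.Nat.Properties using (+-suc; +-identityʳ)
  go : ∀ {a b c i j} → Walk G i a b → Walk G j a c → Walk G (i + j) b c
  go here acc = acc
  go {b = b} {c = c} {i = suc i} {j = j} (step e w) acc =
    subst (λ t → Walk G t b c) (+-suc i j) (go w (step (Graph.adj-sym G e) acc))

powSym : ∀ {N} {G : Graph N} {k u v} → PowAdj G k u v → PowAdj G k v u
powSym (neq , m , le , w) = (λ e → neq (sym e)) , m , le , revWalk w

powIrrefl : ∀ {N} {G : Graph N} {k u} → ¬ PowAdj G k u u
powIrrefl (neq , _) = neq refl

_^ᴳ_ : ∀ {N} → Graph N → ℕ → Graph N
G ^ᴳ k = record { Adj = PowAdj G k ; adj-sym = powSym ; irrefl = powIrrefl }

odd : ∀ {N} → Fin N → ℕ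
odd i = 2 * toℕ i + 1

-- An odd prime labeling: a bijection V(G) → {1,3,…,2N-1} (encoded as a
-- bijection Fin N ⤖ Fin N composed with i ↦ 2i+1) with coprime labels on edges.
OddPrimeLabeling : ∀ {N} → Graph N → Set
OddPrimeLabeling {N} G =
  Σ (Fin N ⤖ Fin N) λ ℓ →
    ∀ u v → Adj G u v →
      Coprime (odd (Bijection.to ℓ u)) (odd (Bijection.to ℓ v))

IsOddPrime : ∀ {N} → Graph N → Set
IsOddPrime G = OddPrimeLabeling G

{-# OPTIONS --safe #-}
-- The identity labelling i ↦ 2i+1 works: in P_n² the endpoints of an edge have
-- indices differing by 1 or 2, so their labels differ by 2 or 4. A common divisor
-- of two odd numbers divides their difference, and an odd number has no common
-- divisor with a power of two other than 1.
module Submission where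

open import Defs
open import Data.Nat using (ℕ; _≥_; zero; suc; _+_; _*_; _^_; pred; z≤n; s≤s)
open import Data.Nat.Properties using (+-assoc; +-comm; *-comm)
open import Data.Nat.Divisibility using (_∣_; ∣1⇒≡1; ∣m⇒∣m*n)
open import Data.Nat.Coprimality
  using (Coprime; coprime-+; coprime-factors) renaming (sym to coprime-sym)
open import Data.Nat.Tactic.RingSolver using (solve-∀)
open import Data.Fin using (Fin; toℕ)
open import Data.Fin.Properties using (toℕ-injective)
open import Data.Product using (∃-syntax; _,_)
open import Data.Sum using (_⊎_; inj₁; inj₂)
open import Data.Empty using (⊥-elim)
open import Relation.Binary.PropositionalEquality using (_≡_; refl; sym; trans; cong; subst)
open import Function.Construct.Identity using (⤖-id)

1-coprime : ∀ n → Coprime 1 n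
1-coprime _ (d∣1 , _) = ∣1⇒≡1 d∣1

coprime-+-multiple : ∀ k {m n} → Coprime m n → Coprime (k * n + m) n
coprime-+-multiple zero    coprime = coprime
coprime-+-multiple (suc k) {m} {n} coprime =
  subst (λ t → Coprime t n) (sym (+-assoc n (k * n) m))
        (coprime-+ (coprime-+-multiple k coprime))

odd-coprime-2 : ∀ a → Coprime (2 * a + 1) 2
odd-coprime-2 a =
  subst (λ t → Coprime (t + 1) 2) (*-comm a 2) (coprime-+-multiple a (1-coprime 2))

odd-coprime-2^ : ∀ j a → Coprime (2 ^ j) (2 * a + 1)
odd-coprime-2^ zero    a = 1-coprime (2 * a + 1)
odd-coprime-2^ (suc j) a {d} (d∣2*2^j , d∣odd) =
  odd-coprime-2^ j a (d∣2^j , d∣odd)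
  where
  d∣2^j : d ∣ 2 ^ j
  d∣2^j = coprime-factors (coprime-sym (odd-coprime-2 a))
                          (d∣2*2^j , ∣m⇒∣m*n (2 ^ j) d∣odd)

odd-coprime-+2^ : ∀ j a → Coprime (2 * a + 1) (2 * a + 1 + 2 ^ j)
odd-coprime-+2^ j a = coprime-sym (coprime-+ (odd-coprime-2^ j a))

TwoPowerApart : ℕ → ℕ → Set
TwoPowerApart a b = ∃[ j ] b ≡ a + 2 ^ j

twoPowerApart⇒odd-coprime : ∀ {a b} → TwoPowerApart a b → Coprime (2 * a + 1) (2 * b + 1)
twoPowerApart⇒odd-coprime {a} (j , refl) =
  subst (Coprime (2 * a + 1)) (sym (doubled a (2 ^ j))) (odd-coprime-+2^ (suc j) a)
  where
  doubled : ∀ a p → 2 * (a + p) + 1 ≡ 2 * a + 1 + 2 * p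
  doubled = solve-∀

suc≡+2^0 : ∀ {a b} → suc a ≡ b → TwoPowerApart a b
suc≡+2^0 {a} refl = 0 , +-comm 1 a

suc-suc≡+2^1 : ∀ {a b} → suc (suc a) ≡ b → TwoPowerApart a b
suc-suc≡+2^1 {a} refl = 1 , +-comm 2 a

path²-adj⇒twoPowerApart : ∀ {n} {u v : Fin n} → PowAdj (P n) 2 u v →
  TwoPowerApart (toℕ u) (toℕ v) ⊎ TwoPowerApart (toℕ v) (toℕ u)
path²-adj⇒twoPowerApart (u≢v , _ , z≤n , here) = ⊥-elim (u≢v refl)
path²-adj⇒twoPowerApart (_ , _ , s≤s z≤n , step (inj₁ e) here) = inj₁ (suc≡+2^0 e)
path²-adj⇒twoPowerApart (_ , _ , s≤s z≤n , step (inj₂ e) here) = inj₂ (suc≡+2^0 e)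
path²-adj⇒twoPowerApart (_ , _ , s≤s (s≤s z≤n) , step (inj₁ e₁) (step (inj₁ e₂) here)) =
  inj₁ (suc-suc≡+2^1 (trans (cong suc e₁) e₂))
path²-adj⇒twoPowerApart (_ , _ , s≤s (s≤s z≤n) , step (inj₂ e₁) (step (inj₂ e₂) here)) =
  inj₂ (suc-suc≡+2^1 (trans (cong suc e₂) e₁))
path²-adj⇒twoPowerApart (u≢v , _ , s≤s (s≤s z≤n) , step (inj₁ e₁) (step (inj₂ e₂) here)) =
  ⊥-elim (u≢v (toℕ-injective (cong pred (trans e₁ (sym e₂)))))
path²-adj⇒twoPowerApart (u≢v , _ , s≤s (s≤s z≤n) , step (inj₂ e₁) (step (inj₁ e₂) here)) =
  ⊥-elim (u≢v (toℕ-injective (trans (sym e₁) e₂)))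

path²-identity-labelling : ∀ {n} (u v : Fin n) → PowAdj (P n) 2 u v → Coprime (odd u) (odd v)
path²-identity-labelling u v adj with path²-adj⇒twoPowerApart adj
... | inj₁ apart = twoPowerApart⇒odd-coprime apart
... | inj₂ apart = coprime-sym (twoPowerApart⇒odd-coprime apart)

mainTheorem16 : (n : ℕ) → n ≥ 1 → IsOddPrime (P n ^ᴳ 2)
mainTheorem16 n _ = ⤖-id (Fin n) , path²-identity-labelling
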